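{- Let $q$ be a prime power. Let $2\leq s\leq k$ be integers. We have the following estimate on $n_q(k,s)$: \[ n_q(k,s)\leq \frac{q^3-q+1}{q^4}\left[{k \atop s}\right]_q. \]
   Context: For a $(k-s)$-dimensional affine subspace $H$ of $\mathbb{F}_q^k$ not passing through the origin, $n_q(k,s)$ denotes the number of $s$-dimensional affine subspaces through the origin (i.e. $s$-dimensional linear subspaces) of $\mathbb{F}_q^k$ that are disjoint from $H$; this number is independent of the choice of $H$. Here $\left[{k \atop s}\right]_q$ denotes the $q$-binomial (Gaussian) coefficient: for integers $0\leq s\leq k$, $\left[{k \atop s}\right]_q = \frac{(q^k - 1) \cdots (q^{k - s+ 1} - 1)}{(q^s - 1) \cdots (q - 1)}$ (empty product equal to $1$); it equals the number of $s$-dimensional linear subspaces of $\mathbb{F}_q^k$. -}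

module Defs where

open import Level using (Level; _⊔_; suc)
open import Algebra.Bundles using (CommutativeRing)
open import Data.Nat as ℕ using (ℕ; zero) renaming (suc to sucℕ)
open import Data.Fin as Fin using (Fin)
open import Data.Product using (Σ; ∃; _×_; _,_)
open import Function.Bundles using (_⇔_)
open import Relation.Nullary using (¬_)
open import Relation.Binary.PropositionalEquality using (_≡_)

record Field (c ℓ : Level) : Set (suc (c ⊔ ℓ)) where
  field
    commRing : CommutativeRing c ℓ
  open CommutativeRing commRing public
  field
    0≉1     : ¬ (0# ≈ 1#)
    inverse : ∀ x → ¬ (x ≈ 0#) → Σ Carrier (λ y → (x * y) ≈ 1#)

record FiniteField (c ℓ : Level) (q : ℕ) : Set (suc (c ⊔ ℓ)) where
  field
    F       : Field c ℓ
  open Field F public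
  field
    enum       : Fin q → Carrier
    enum-inj   : ∀ i j → enum i ≈ enum j → i ≡ j
    enum-surj  : ∀ x → Σ (Fin q) (λ i → enum i ≈ x)

module Geometry {c ℓ : Level} {q : ℕ} (𝔽 : FiniteField c ℓ q) where
  open FiniteField 𝔽

  Vec : ℕ → Set c
  Vec k = Fin k → Carrier

  _≈ᵥ_ : ∀ {k} → Vec k → Vec k → Set ℓ
  u ≈ᵥ v = ∀ i → u i ≈ v i

  0ᵥ : ∀ {k} → Vec k
  0ᵥ _ = 0#

  _+ᵥ_ : ∀ {k} → Vec k → Vec k → Vec k
  (u +ᵥ v) i = u i + v i

  _-ᵥ_ : ∀ {k} → Vec k → Vec k → Vec k
  (u -ᵥ v) i = u i + (- v i)

  _·_ : ∀ {k} → Carrier → Vec k → Vec k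
  (a · v) i = a * v i

  lincomb : ∀ {k} (s : ℕ) → (Fin s → Carrier) → (Fin s → Vec k) → Vec k
  lincomb zero     c v = 0ᵥ
  lincomb (sucℕ s) c v = (c Fin.zero · v Fin.zero) +ᵥ lincomb s (λ j → c (Fin.suc j)) (λ j → v (Fin.suc j))

  LinearlyIndependent : ∀ {k} (s : ℕ) → (Fin s → Vec k) → Set (c ⊔ ℓ)
  LinearlyIndependent s v = ∀ (a : Fin s → Carrier) → lincomb s a v ≈ᵥ 0ᵥ → ∀ j → a j ≈ 0#

  record Subspace (k : ℕ) : Set (suc (c ⊔ ℓ)) where
    field
      _∈S   : Vec k → Set (c ⊔ ℓ)
      resp  : ∀ {u v} → u ≈ᵥ v → u ∈S → v ∈S
      zero∈ : 0ᵥ ∈S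
      +∈    : ∀ {u v} → u ∈S → v ∈S → (u +ᵥ v) ∈S
      ·∈    : ∀ a {v} → v ∈S → (a · v) ∈S

  open Subspace public

  HasDim : ∀ {k} → Subspace k → ℕ → Set (c ⊔ ℓ)
  HasDim {k} W d = Σ (Fin d → Vec k) λ b →
      (∀ j → (W ∈S) (b j))
    × LinearlyIndependent d b
    × (∀ x → (W ∈S) x → Σ (Fin d → Carrier) λ a → x ≈ᵥ lincomb d a b)

  record AffineSubspace (k : ℕ) : Set (suc (c ⊔ ℓ)) where
    field
      point     : Vec k
      direction : Subspace k

  _∈A_ : ∀ {k} → Vec k → AffineSubspace k → Set (c ⊔ ℓ)
  x ∈A H = (AffineSubspace.direction H ∈S) (x -ᵥ AffineSubspace.point H)

  AffineHasDim : ∀ {k} → AffineSubspace k → ℕ → Set (c ⊔ ℓ)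
  AffineHasDim H d = HasDim (AffineSubspace.direction H) d

  AvoidsOrigin : ∀ {k} → AffineSubspace k → Set (c ⊔ ℓ)
  AvoidsOrigin H = ¬ (0ᵥ ∈A H)

  Disjoint : ∀ {k} → Subspace k → AffineSubspace k → Set (c ⊔ ℓ)
  Disjoint W H = ∀ x → (W ∈S) x → ¬ (x ∈A H)

  _≋_ : ∀ {k} → Subspace k → Subspace k → Set (c ⊔ ℓ)
  U ≋ W = ∀ x → ((U ∈S) x ⇔ (W ∈S) x)

  Counted : ∀ {k} (s : ℕ) → AffineSubspace k → Subspace k → Set (c ⊔ ℓ)
  Counted s H W = HasDim W s × Disjoint W H

  -- "the number of s-dimensional linear subspaces disjoint from H is n":
  -- an enumeration Fin n → such subspaces which is injective and surjective
  -- up to equality of subspaces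
  IsCount : ∀ {k} (s : ℕ) → AffineSubspace k → ℕ → Set (suc (c ⊔ ℓ))
  IsCount s H n = Σ (Fin n → Subspace _) λ f →
      (∀ i → Counted s H (f i))
    × (∀ i j → f i ≋ f j → i ≡ j)
    × (∀ W → Counted s H W → Σ (Fin n) λ i → f i ≋ W)

-- Gaussian binomial [k s]_q = num / den with
--   num = (q^k - 1)(q^(k-1) - 1)...(q^(k-s+1) - 1),  den = (q^s - 1)...(q - 1)
gaussNum : ℕ → ℕ → ℕ → ℕ
gaussNum q k zero     = 1
gaussNum q k (sucℕ s) = (q ℕ.^ (k ℕ.∸ s) ℕ.∸ 1) ℕ.* gaussNum q k s

gaussDen : ℕ → ℕ → ℕ
gaussDen q zero     = 1
gaussDen q (sucℕ s) = (q ℕ.^ sucℕ s ℕ.∸ 1) ℕ.* gaussDen q s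

{-# OPTIONS --safe #-}
module Submission where

-- Count frames, i.e. ordered linearly independent s-tuples. Each of the n subspaces W
-- counted by n_q(k,s) contains ∏_{j<s}(q^s − q^j) frames, these frame sets are pairwise
-- disjoint, and a frame t spans a subspace disjoint from H = p + dir H exactly when
-- p ∉ ⟨t⟩ + dir H. Such frames are chosen vector by vector while tracking
-- d = dim(⟨t⟩ + dir H): the next vector either avoids ⟨p⟩ + ⟨t⟩ + dir H (d grows; at most
-- q^k − q^(d+1) choices) or lies in ⟨t⟩ + dir H but outside ⟨t⟩ (at most q^d − q^i); any
-- other choice puts p into the sum. As d starts at k − s and stays below k, a step of the
-- second kind is forced, and the resulting recursion is at most (q³ − q + 1)/q⁴ times
-- ∏_{j<s}(q^k − q^j). Dividing the two products by q^(s(s−1)/2) leaves the numerator and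
-- the denominator of the Gaussian binomial.

open import Defs
open import Level using (Level)
open import Data.Nat.Base using (ℕ)

module FrameArithmetic where
  open import Data.Nat.Base
  open import Data.Nat.Properties
  open import Data.Nat.Solver using (module +-*-Solver)
  open import Data.Sum using (inj₁; inj₂)
  open import Relation.Nullary using (yes; no)
  open import Relation.Binary.PropositionalEquality using (_≡_; refl; sym; trans; cong; cong₂; subst)

  open +-*-Solver using (solve; _:+_; _:*_; _:^_; _:=_; con)
  open ≤-Reasoning

  frameCount : (q k i r : ℕ) → ℕ
  frameCount q k i zero    = 1
  frameCount q k i (suc r) = (q ^ k ∸ q ^ i) * frameCount q k (suc i) r

  -- i frame vectors chosen, d = dim (their span + dir H), r vectors still to choose.
  disjointFrameBound : (q k i d r : ℕ) → ℕ
  disjointFrameBound q k i d zero    = 1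
  disjointFrameBound q k i d (suc r) =
    (q ^ k ∸ q ^ suc d) * disjointFrameBound q k (suc i) (suc d) r
      + (q ^ d ∸ q ^ i) * disjointFrameBound q k (suc i) d r

  powerProduct : ℕ → ℕ → ℕ
  powerProduct q zero    = 1
  powerProduct q (suc s) = powerProduct q s * q ^ s

  m+o≡n⇒m≤n : ∀ {m n} o → m + o ≡ n → m ≤ n
  m+o≡n⇒m≤n {m} o refl = m≤m+n m o

  m≡n+o⇒m∸n≡o : ∀ {m n o} → m ≡ n + o → m ∸ n ≡ o
  m≡n+o⇒m∸n≡o {n = n} {o} refl = m+n∸m≡n n o

  ∸-split : ∀ {a b c} → a ≤ b → b ≤ c → c ∸ a ≡ (c ∸ b) + (b ∸ a)
  ∸-split {a} {b} {c} a≤b b≤c = begin-equality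
    c ∸ a              ≡⟨ cong (_∸ a) (sym (m∸n+n≡m b≤c)) ⟩
    c ∸ b + b ∸ a      ≡⟨ +-∸-assoc (c ∸ b) a≤b ⟩
    c ∸ b + (b ∸ a)    ∎

  q^k∸q^i≡q^i*[q^[k∸i]∸1] : ∀ q {i k} → i ≤ k → q ^ k ∸ q ^ i ≡ q ^ i * (q ^ (k ∸ i) ∸ 1)
  q^k∸q^i≡q^i*[q^[k∸i]∸1] q {i} {k} i≤k = begin-equality
    q ^ k ∸ q ^ i                        ≡⟨ cong (λ e → q ^ e ∸ q ^ i) (sym (m+[n∸m]≡n i≤k)) ⟩
    q ^ (i + (k ∸ i)) ∸ q ^ i            ≡⟨ cong₂ _∸_ (^-distribˡ-+-* q i (k ∸ i)) (sym (*-identityʳ (q ^ i))) ⟩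
    q ^ i * q ^ (k ∸ i) ∸ q ^ i * 1      ≡⟨ *-distribˡ-∸ (q ^ i) (q ^ (k ∸ i)) 1 ⟨
    q ^ i * (q ^ (k ∸ i) ∸ 1)            ∎

  frameCount-snoc : ∀ q k i r → frameCount q k i (suc r) ≡ frameCount q k i r * (q ^ k ∸ q ^ (i + r))
  frameCount-snoc q k i zero    = trans (*-comm _ 1) (cong (λ e → 1 * (q ^ k ∸ q ^ e)) (sym (+-identityʳ i)))
  frameCount-snoc q k i (suc r) = begin-equality
    x * frameCount q k (suc i) (suc r)                       ≡⟨ cong (x *_) (frameCount-snoc q k (suc i) r) ⟩
    x * (frameCount q k (suc i) r * (q ^ k ∸ q ^ (suc i + r))) ≡⟨ *-assoc x _ _ ⟨
    x * frameCount q k (suc i) r * (q ^ k ∸ q ^ (suc i + r))   ≡⟨ cong (λ e → x * frameCount q k (suc i) r * (q ^ k ∸ q ^ e)) (+-suc i r) ⟨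
    x * frameCount q k (suc i) r * (q ^ k ∸ q ^ (i + suc r))   ∎
    where x = q ^ k ∸ q ^ i

  frameCount-shift : ∀ q k i r → frameCount q (suc k) (suc i) r ≡ q ^ r * frameCount q k i r
  frameCount-shift q k i zero    = refl
  frameCount-shift q k i (suc r) = begin-equality
    (q * q ^ k ∸ q * q ^ i) * frameCount q (suc k) (suc (suc i)) r
      ≡⟨ cong₂ _*_ (sym (*-distribˡ-∸ q (q ^ k) (q ^ i))) (frameCount-shift q k (suc i) r) ⟩
    q * x * (q ^ r * frameCount q k (suc i) r)                     ≡⟨ solve 4 (λ q x p f → q :* x :* (p :* f) := q :* p :* (x :* f)) refl q x (q ^ r) _ ⟩
    q * q ^ r * (x * frameCount q k (suc i) r)                     ∎
    where x = q ^ k ∸ q ^ i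

  frameCount≡powerProduct*gaussNum : ∀ q {k} s → s ≤ k → frameCount q k 0 s ≡ powerProduct q s * gaussNum q k s
  frameCount≡powerProduct*gaussNum q zero    _  = refl
  frameCount≡powerProduct*gaussNum q {k} (suc s) s<k = begin-equality
    frameCount q k 0 (suc s)                                ≡⟨ frameCount-snoc q k 0 s ⟩
    frameCount q k 0 s * (q ^ k ∸ q ^ s)
      ≡⟨ cong₂ _*_ (frameCount≡powerProduct*gaussNum q s (<⇒≤ s<k)) (q^k∸q^i≡q^i*[q^[k∸i]∸1] q (<⇒≤ s<k)) ⟩
    powerProduct q s * gaussNum q k s * (q ^ s * (q ^ (k ∸ s) ∸ 1))
      ≡⟨ solve 4 (λ p g x y → p :* g :* (x :* y) := p :* x :* (y :* g)) refl (powerProduct q s) (gaussNum q k s) (q ^ s) _ ⟩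
    powerProduct q s * q ^ s * ((q ^ (k ∸ s) ∸ 1) * gaussNum q k s) ∎

  frameCount≡powerProduct*gaussDen : ∀ q s → frameCount q s 0 s ≡ powerProduct q s * gaussDen q s
  frameCount≡powerProduct*gaussDen q zero    = refl
  frameCount≡powerProduct*gaussDen q (suc s) = begin-equality
    x * frameCount q (suc s) 1 s                   ≡⟨ cong (x *_) (frameCount-shift q s 0 s) ⟩
    x * (q ^ s * frameCount q s 0 s)               ≡⟨ cong (λ f → x * (q ^ s * f)) (frameCount≡powerProduct*gaussDen q s) ⟩
    x * (q ^ s * (powerProduct q s * gaussDen q s))
      ≡⟨ solve 4 (λ x y p g → x :* (y :* (p :* g)) := p :* y :* (x :* g)) refl x (q ^ s) (powerProduct q s) (gaussDen q s) ⟩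
    powerProduct q s * q ^ s * (x * gaussDen q s) ∎
    where x = q ^ suc s ∸ 1

  module Bounds (m : ℕ) where

    q : ℕ
    q = suc m

    κ : ℕ
    κ = q ^ 3 ∸ q + 1

    κ≡ : κ ≡ m * q * suc q + 1
    κ≡ = cong (_+ 1) (m≡n+o⇒m∸n≡o
      (solve 1 (λ m → (con 1 :+ m) :^ 3 := (con 1 :+ m) :+ m :* (con 1 :+ m) :* (con 2 :+ m)) refl m))

    q^2≤κ : q ^ 2 ≤ κ
    q^2≤κ = m+o≡n⇒m≤n (m * m * suc q) (trans
      (solve 1 (λ m → (con 1 :+ m) :^ 2 :+ m :* m :* (con 2 :+ m) := m :* (con 1 :+ m) :* (con 2 :+ m) :+ con 1) refl m)
      (sym κ≡))

    q^[1+n]∸q^n≡m*q^n : ∀ n → q ^ suc n ∸ q ^ n ≡ m * q ^ n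
    q^[1+n]∸q^n≡m*q^n n = m≡n+o⇒m∸n≡o {n = q ^ n} refl

    q^d≡q^i+[q^d∸q^i] : ∀ {i d} → i ≤ d → q ^ d ≡ q ^ i + (q ^ d ∸ q ^ i)
    q^d≡q^i+[q^d∸q^i] i≤d = sym (m+[n∸m]≡n (^-monoʳ-≤ q i≤d))

    q^[1+d]∸q^i : ∀ {i d} → i ≤ d → q ^ suc d ∸ q ^ i ≡ q * (q ^ d ∸ q ^ i) + m * q ^ i
    q^[1+d]∸q^i {i} {d} i≤d = m≡n+o⇒m∸n≡o {n = q ^ i} (begin-equality
      q * q ^ d      ≡⟨ cong (q *_) (q^d≡q^i+[q^d∸q^i] i≤d) ⟩
      q * (z + w)    ≡⟨ solve 3 (λ m z w → (con 1 :+ m) :* (z :+ w) := z :+ ((con 1 :+ m) :* w :+ m :* z)) refl m z w ⟩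
      z + (q * w + m * z) ∎)
      where z = q ^ i; w = q ^ d ∸ q ^ i

    q^k∸q^i-split : ∀ {i d k} → i ≤ d → suc d ≤ k →
      q ^ k ∸ q ^ i ≡ (q ^ k ∸ q ^ suc d) + (q * (q ^ d ∸ q ^ i) + m * q ^ i)
    q^k∸q^i-split {i} {d} {k} i≤d d<k = trans (∸-split (^-monoʳ-≤ q (m≤n⇒m≤1+n i≤d)) (^-monoʳ-≤ q d<k))
                                              (cong (q ^ k ∸ q ^ suc d +_) (q^[1+d]∸q^i i≤d))

    q^k∸q^i-lower : ∀ {i d k} → i ≤ suc d → suc d ≤ k → (q ^ k ∸ q ^ suc d) + q * (q ^ d ∸ q ^ i) ≤ q ^ k ∸ q ^ i
    q^k∸q^i-lower {i} {d} {k} i≤1+d d<k = begin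
      (q ^ k ∸ q ^ suc d) + q * (q ^ d ∸ q ^ i)     ≡⟨ cong (q ^ k ∸ q ^ suc d +_) (*-distribˡ-∸ q (q ^ d) (q ^ i)) ⟩
      (q ^ k ∸ q ^ suc d) + (q ^ suc d ∸ q ^ suc i) ≤⟨ +-monoʳ-≤ (q ^ k ∸ q ^ suc d) (∸-monoʳ-≤ (q ^ suc d) (^-monoʳ-≤ q (n≤1+n i))) ⟩
      (q ^ k ∸ q ^ suc d) + (q ^ suc d ∸ q ^ i)     ≡⟨ ∸-split (^-monoʳ-≤ q i≤1+d) (^-monoʳ-≤ q d<k) ⟨
      q ^ k ∸ q ^ i                                 ∎

    [q^d∸q^i]*-monoʳ-≤ : ∀ {i d x y} → (i < d → x ≤ y) → (q ^ d ∸ q ^ i) * x ≤ (q ^ d ∸ q ^ i) * y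
    [q^d∸q^i]*-monoʳ-≤ {i} {d} x≤y with i <? d
    ... | yes i<d = *-monoʳ-≤ (q ^ d ∸ q ^ i) (x≤y i<d)
    ... | no  i≮d rewrite m≤n⇒m∸n≡0 (^-monoʳ-≤ q (≮⇒≥ i≮d)) = z≤n

    disjointFrameBound≤frameCount : ∀ {k} i d r → i ≤ suc d → d + r ≤ k →
      disjointFrameBound q k i d r ≤ frameCount q k i r
    disjointFrameBound≤frameCount i d zero    _      _     = ≤-refl
    disjointFrameBound≤frameCount {k} i d (suc r) i≤1+d d+r<k = begin
      A * disjointFrameBound q k (suc i) (suc d) r + B * disjointFrameBound q k (suc i) d r
        ≤⟨ +-mono-≤ (*-monoʳ-≤ A (disjointFrameBound≤frameCount (suc i) (suc d) r (s≤s i≤1+d) 1+d+r≤k))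
                    ([q^d∸q^i]*-monoʳ-≤ (λ i<d → disjointFrameBound≤frameCount (suc i) d r (m≤n⇒m≤1+n i<d) d+r≤k)) ⟩
      A * F + B * F         ≡⟨ *-distribʳ-+ F A B ⟨
      (A + B) * F           ≤⟨ *-monoˡ-≤ F (≤-trans (+-monoʳ-≤ A (m≤n*m B q)) (q^k∸q^i-lower i≤1+d (≤-trans (s≤s (m≤m+n d r)) 1+d+r≤k))) ⟩
      (q ^ k ∸ q ^ i) * F   ∎
      where
        A = q ^ k ∸ q ^ suc d
        B = q ^ d ∸ q ^ i
        F = frameCount q k (suc i) r
        1+d+r≤k : suc d + r ≤ k
        1+d+r≤k = subst (_≤ k) (+-suc d r) d+r<k
        d+r≤k : d + r ≤ k
        d+r≤k = ≤-trans (+-monoʳ-≤ d (n≤1+n r)) d+r<k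

    q*b*disjointFrameBound≤κ*frameCount-step : ∀ {k} b i d r → i ≤ suc d → suc d ≤ k →
      q * b * disjointFrameBound q k (suc i) (suc d) r ≤ κ * frameCount q k (suc i) r →
      (i < d → b * disjointFrameBound q k (suc i) d r ≤ κ * frameCount q k (suc i) r) →
      q * b * disjointFrameBound q k i d (suc r) ≤ κ * frameCount q k i (suc r)
    q*b*disjointFrameBound≤κ*frameCount-step {k} b i d r i≤1+d d<k bound-grow bound-stay = begin
      q * b * (A * Ta + B * Tb)
        ≡⟨ solve 6 (λ q b A Ta B Tb → q :* b :* (A :* Ta :+ B :* Tb) := A :* (q :* b :* Ta) :+ q :* (B :* (b :* Tb))) refl q b A Ta B Tb ⟩
      A * (q * b * Ta) + q * (B * (b * Tb))   ≤⟨ +-mono-≤ (*-monoʳ-≤ A bound-grow) (*-monoʳ-≤ q ([q^d∸q^i]*-monoʳ-≤ bound-stay)) ⟩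
      A * (κ * F) + q * (B * (κ * F))
        ≡⟨ solve 5 (λ q κ A B F → A :* (κ :* F) :+ q :* (B :* (κ :* F)) := κ :* ((A :+ q :* B) :* F)) refl q κ A B F ⟩
      κ * ((A + q * B) * F)                   ≤⟨ *-monoʳ-≤ κ (*-monoˡ-≤ F (q^k∸q^i-lower i≤1+d d<k)) ⟩
      κ * ((q ^ k ∸ q ^ i) * F)               ∎
      where
        A  = q ^ k ∸ q ^ suc d
        B  = q ^ d ∸ q ^ i
        Ta = disjointFrameBound q k (suc i) (suc d) r
        Tb = disjointFrameBound q k (suc i) d r
        F  = frameCount q k (suc i) r

    -- In both identities the last summand on the left is the difference of the two sides,
    -- a polynomial in m = q − 1 with nonnegative coefficients.
    base-identity₃ : ∀ z w →
      q ^ 3 * (m * (q * (z + w)) + w) + (m * z + m * q * (m * q) * (z + w))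
        ≡ (m * q * suc q + 1) * (m * (q * (z + w)) + (q * w + m * z))
    base-identity₃ = solve 3 (λ m z w →
      let q = con 1 :+ m; A = m :* (q :* (z :+ w)) in
      q :^ 3 :* (A :+ w) :+ (m :* z :+ m :* q :* (m :* q) :* (z :+ w))
        := (m :* q :* (con 1 :+ q) :+ con 1) :* (A :+ (q :* w :+ m :* z))) refl m

    base-identity₄ : ∀ z w →
      q ^ 4 * (m * (q * (q * z + w)) * (q * (m * z + w)) + (m * z + w) * (m * (q * (q * z + w)) + w))
        + m * q * suc q * z * (q * w * (m * q * q + 1) + m * z * (q ^ 4 + 1))
        ≡ (m * q * suc q + 1) * ((m * (q * (q * z + w)) + (q * (m * z + w) + m * z))
                                 * (m * (q * (q * z + w)) + (q * w + m * (q * z))))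
    base-identity₄ = solve 3 (λ m z w →
      let q = con 1 :+ m; A = m :* (q :* (q :* z :+ w)); B = m :* z :+ w in
      q :^ 4 :* (A :* (q :* B) :+ B :* (A :+ w)) :+ m :* q :* (con 1 :+ q) :* z :* (q :* w :* (m :* q :* q :+ con 1) :+ m :* z :* (q :^ 4 :+ con 1))
        := (m :* q :* (con 1 :+ q) :+ con 1) :* ((A :+ (q :* B :+ m :* z)) :* (A :+ (q :* w :+ m :* (q :* z))))) refl m

    q^[2+d]∸q^[1+d] : ∀ {i d} → i ≤ d → q ^ suc (suc d) ∸ q ^ suc d ≡ m * (q * (q ^ i + (q ^ d ∸ q ^ i)))
    q^[2+d]∸q^[1+d] {d = d} i≤d = trans (q^[1+n]∸q^n≡m*q^n (suc d)) (cong (λ x → m * (q * x)) (q^d≡q^i+[q^d∸q^i] i≤d))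

    q^3*disjointFrameBound≤κ*frameCount-base : ∀ i d → i ≤ d →
      q ^ 3 * disjointFrameBound q (2 + d) i d 1 ≤ κ * frameCount q (2 + d) i 1
    q^3*disjointFrameBound≤κ*frameCount-base i d i≤d = begin
      q ^ 3 * disjointFrameBound q (2 + d) i d 1      ≡⟨ cong (q ^ 3 *_) (cong₂ _+_ (trans (*-identityʳ _) A≡) (*-identityʳ w)) ⟩
      q ^ 3 * (A + w)                                 ≤⟨ m+o≡n⇒m≤n _ (base-identity₃ z w) ⟩
      (m * q * suc q + 1) * (A + (q * w + m * z))     ≡⟨ cong₂ _*_ κ≡ F≡ ⟨
      κ * frameCount q (2 + d) i 1                    ∎
      where
        z = q ^ i
        w = q ^ d ∸ q ^ i
        A = m * (q * (z + w))
        A≡ = q^[2+d]∸q^[1+d] i≤d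
        F≡ : frameCount q (2 + d) i 1 ≡ A + (q * w + m * z)
        F≡ = trans (*-identityʳ _) (trans (q^k∸q^i-split i≤d (n≤1+n _)) (cong (_+ (q * w + m * z)) A≡))

    q^4*disjointFrameBound≤κ*frameCount-base : ∀ i d → i ≤ d →
      q ^ 4 * disjointFrameBound q (2 + d) i d 2 ≤ κ * frameCount q (2 + d) i 2
    q^4*disjointFrameBound≤κ*frameCount-base i d i≤d with m≤n⇒m<n∨m≡n i≤d
    ... | inj₂ refl
        rewrite n∸n≡0 (q ^ suc (suc d)) | n∸n≡0 (q ^ suc d) | n∸n≡0 (q ^ d)
              | *-zeroʳ (q ^ suc (suc d) ∸ q ^ suc d) | *-zeroʳ (q ^ 4) = z≤n
    ... | inj₁ i<d = begin
      q ^ 4 * disjointFrameBound q (2 + d) i d 2                 ≡⟨ cong (q ^ 4 *_) T≡ ⟩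
      q ^ 4 * (A * (q * B) + B * (A + w))                         ≤⟨ m+o≡n⇒m≤n _ (base-identity₄ z w) ⟩
      (m * q * suc q + 1) * ((A + (q * B + m * z)) * (A + (q * w + m * (q * z))))
                                                                  ≡⟨ cong₂ _*_ κ≡ F≡ ⟨
      κ * frameCount q (2 + d) i 2                                ∎
      where
        z = q ^ i
        w = q ^ d ∸ q ^ suc i
        A = m * (q * (q * z + w))
        B = m * z + w
        A≡ = q^[2+d]∸q^[1+d] i<d
        B≡ : q ^ d ∸ q ^ i ≡ B
        B≡ = m≡n+o⇒m∸n≡o {n = z} (trans (q^d≡q^i+[q^d∸q^i] i<d) (+-assoc z (m * z) w))
        T≡ : disjointFrameBound q (2 + d) i d 2 ≡ A * (q * B) + B * (A + w)
        T≡ = cong₂ _+_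
          (cong₂ _*_ A≡ (begin-equality
            (q ^ suc (suc d) ∸ q ^ suc (suc d)) * 1 + (q ^ suc d ∸ q ^ suc i) * 1
                                                    ≡⟨ cong (λ x → x * 1 + (q ^ suc d ∸ q ^ suc i) * 1) (n∸n≡0 (q ^ suc (suc d))) ⟩
            (q ^ suc d ∸ q ^ suc i) * 1             ≡⟨ *-identityʳ _ ⟩
            q * q ^ d ∸ q * q ^ i                   ≡⟨ *-distribˡ-∸ q (q ^ d) (q ^ i) ⟨
            q * (q ^ d ∸ q ^ i)                     ≡⟨ cong (q *_) B≡ ⟩
            q * B                                   ∎))
          (cong₂ _*_ B≡ (cong₂ _+_ (trans (*-identityʳ _) A≡) (*-identityʳ w)))
        F≡ : frameCount q (2 + d) i 2 ≡ (A + (q * B + m * z)) * (A + (q * w + m * (q * z)))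
        F≡ = cong₂ _*_
          (trans (q^k∸q^i-split (<⇒≤ i<d) (n≤1+n _)) (cong₂ (λ a b → a + (q * b + m * z)) A≡ B≡))
          (trans (*-identityʳ _) (trans (q^k∸q^i-split i<d (n≤1+n _)) (cong (_+ (q * w + m * (q * z))) A≡)))

    -- With r + 2 + d = k, the r + 2 steps of the q⁴ bound cannot all increase d (which stays
    -- below k); the r + 1 steps of the q³ bound have one dimension to spare.
    q^3*disjointFrameBound≤κ*frameCount : ∀ {k} i d r → i ≤ d → suc (suc r) + d ≡ k →
      q ^ 3 * disjointFrameBound q k i d (suc r) ≤ κ * frameCount q k i (suc r)
    q^3*disjointFrameBound≤κ*frameCount i d zero    i≤d refl = q^3*disjointFrameBound≤κ*frameCount-base i d i≤d
    q^3*disjointFrameBound≤κ*frameCount {k} i d (suc r) i≤d 3+r+d≡k = q*b*disjointFrameBound≤κ*frameCount-step (q ^ 2) i d (suc r) (m≤n⇒m≤1+n i≤d) d<k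
      (q^3*disjointFrameBound≤κ*frameCount (suc i) (suc d) r (s≤s i≤d) (trans (+-suc (suc (suc r)) d) 3+r+d≡k))
      (λ i<d → ≤-trans (*-monoʳ-≤ (q ^ 2) (disjointFrameBound≤frameCount (suc i) d (suc r) (m≤n⇒m≤1+n i<d) d+1+r≤k))
                       (*-monoˡ-≤ _ q^2≤κ))
      where
        d<k : suc d ≤ k
        d<k = subst (suc d ≤_) 3+r+d≡k (s≤s (m≤n+m d (suc (suc r))))
        d+1+r≤k : d + suc r ≤ k
        d+1+r≤k = subst (d + suc r ≤_) 3+r+d≡k (≤-trans (≤-reflexive (+-comm d (suc r))) (≤-trans (n≤1+n _) (n≤1+n _)))

    q^4*disjointFrameBound≤κ*frameCount : ∀ {k} i d r → i ≤ d → suc (suc r) + d ≡ k →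
      q ^ 4 * disjointFrameBound q k i d (suc (suc r)) ≤ κ * frameCount q k i (suc (suc r))
    q^4*disjointFrameBound≤κ*frameCount i d zero    i≤d refl = q^4*disjointFrameBound≤κ*frameCount-base i d i≤d
    q^4*disjointFrameBound≤κ*frameCount {k} i d (suc r) i≤d 3+r+d≡k =
      q*b*disjointFrameBound≤κ*frameCount-step (q ^ 3) i d (suc (suc r)) (m≤n⇒m≤1+n i≤d) d<k
      (q^4*disjointFrameBound≤κ*frameCount (suc i) (suc d) r (s≤s i≤d) (trans (+-suc (suc (suc r)) d) 3+r+d≡k))
      (λ i<d → q^3*disjointFrameBound≤κ*frameCount (suc i) d (suc r) i<d 3+r+d≡k)
      where
        d<k : suc d ≤ k
        d<k = subst (suc d ≤_) 3+r+d≡k (s≤s (m≤n+m d (suc (suc r))))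

    powerProduct>0 : ∀ s → powerProduct q s > 0
    powerProduct>0 zero    = s≤s z≤n
    powerProduct>0 (suc s) = *-mono-≤ (powerProduct>0 s) (m^n>0 q s)

    gaussian-bound : ∀ {n k} s → 2 ≤ s → s ≤ k →
      n * frameCount q s 0 s ≤ disjointFrameBound q k 0 (k ∸ s) s →
      n * q ^ 4 * gaussDen q s ≤ κ * gaussNum q k s
    gaussian-bound {n} {k} s@(suc (suc r)) (s≤s (s≤s z≤n)) s≤k frames≤bound =
      *-cancelʳ-≤ _ _ P {{>-nonZero (powerProduct>0 s)}} (begin
        n * q ^ 4 * gaussDen q s * P         ≡⟨ solve 4 (λ n a g p → n :* a :* g :* p := a :* (n :* (p :* g))) refl n (q ^ 4) (gaussDen q s) P ⟩
        q ^ 4 * (n * (P * gaussDen q s))     ≡⟨ cong (λ x → q ^ 4 * (n * x)) (frameCount≡powerProduct*gaussDen q s) ⟨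
        q ^ 4 * (n * frameCount q s 0 s)     ≤⟨ *-monoʳ-≤ (q ^ 4) frames≤bound ⟩
        q ^ 4 * disjointFrameBound q k 0 (k ∸ s) s ≤⟨ q^4*disjointFrameBound≤κ*frameCount 0 (k ∸ s) r z≤n (m+[n∸m]≡n s≤k) ⟩
        κ * frameCount q k 0 s               ≡⟨ cong (κ *_) (frameCount≡powerProduct*gaussNum q s s≤k) ⟩
        κ * (P * gaussNum q k s)             ≡⟨ solve 3 (λ c p g → c :* (p :* g) := c :* g :* p) refl κ P (gaussNum q k s) ⟩
        κ * gaussNum q k s * P               ∎)
      where P = powerProduct q s

module Counting where
  open import Data.Nat.Base
  open import Data.Nat.Properties
  open import Data.Fin.Base using (Fin; zero; suc)
  import Data.Fin.Properties as Finₚ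
  open import Data.List.Base using (List; []; _∷_; length; filter; map; cartesianProductWith)
  open import Data.List.Properties using (length-++; length-map)
  open import Data.List.Relation.Unary.All as All using (All; []; _∷_)
  open import Data.List.Relation.Unary.Any using (here; there)
  open import Data.List.Relation.Unary.AllPairs using ([]; _∷_)
  import Data.List.Membership.Setoid as Membership
  import Data.List.Relation.Unary.Unique.Setoid as Unique
  open import Data.Product.Base using (Σ; _×_; _,_)
  open import Data.Empty using (⊥-elim)
  open import Data.Vec.Functional using (tail)
  open import Algebra.Properties.CommutativeMonoid.Sum +-0-commutativeMonoid using (sum; sum-replicate-zero; sum-cong-≗; ∑-distrib-+)
  open import Function.Base using (_∘_)
  open import Relation.Nullary using (¬_; Dec; yes; no)
  open import Relation.Nullary.Decidable using (_×-dec_; ¬?)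
  open import Relation.Binary.Bundles using (Setoid)
  open import Relation.Binary.PropositionalEquality using (_≡_; refl; sym; trans; cong; cong₂; subst)
  open import Data.Nat.Solver using (module +-*-Solver)
  open +-*-Solver using (solve; _:+_; _:=_)

  module _ {a} {A : Set a} where

    sumOver : (A → ℕ) → List A → ℕ
    sumOver g []       = 0
    sumOver g (x ∷ xs) = g x + sumOver g xs

    sumOver-mono-≤ : ∀ {g h : A → ℕ} xs → (∀ x → g x ≤ h x) → sumOver g xs ≤ sumOver h xs
    sumOver-mono-≤ []       g≤h = z≤n
    sumOver-mono-≤ (x ∷ xs) g≤h = +-mono-≤ (g≤h x) (sumOver-mono-≤ xs g≤h)

    sumOver-cong : ∀ {g h : A → ℕ} xs → (∀ x → g x ≡ h x) → sumOver g xs ≡ sumOver h xs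
    sumOver-cong []       g≡h = refl
    sumOver-cong (x ∷ xs) g≡h = cong₂ _+_ (g≡h x) (sumOver-cong xs g≡h)

    sumOver-0 : ∀ xs → sumOver (λ _ → 0) xs ≡ 0
    sumOver-0 []       = refl
    sumOver-0 (x ∷ xs) = sumOver-0 xs

    sumOver-+ : ∀ (g h : A → ℕ) xs → sumOver (λ x → g x + h x) xs ≡ sumOver g xs + sumOver h xs
    sumOver-+ g h []       = refl
    sumOver-+ g h (x ∷ xs) = trans (cong (g x + h x +_) (sumOver-+ g h xs))
      (solve 4 (λ a b c d → (a :+ b) :+ (c :+ d) := (a :+ c) :+ (b :+ d)) refl (g x) (h x) (sumOver g xs) (sumOver h xs))

    sumOver-*ʳ : ∀ (g : A → ℕ) n xs → sumOver (λ x → g x * n) xs ≡ sumOver g xs * n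
    sumOver-*ʳ g n []       = refl
    sumOver-*ʳ g n (x ∷ xs) = trans (cong (g x * n +_) (sumOver-*ʳ g n xs)) (sym (*-distribʳ-+ n (g x) (sumOver g xs)))

    sum-sumOver-comm : ∀ n (h : Fin n → A → ℕ) xs → sum (λ j → sumOver (h j) xs) ≡ sumOver (λ x → sum (λ j → h j x)) xs
    sum-sumOver-comm n h []       = sum-replicate-zero n
    sum-sumOver-comm n h (x ∷ xs) = trans (∑-distrib-+ (λ j → h j x) (λ j → sumOver (h j) xs))
                                          (cong (sum (λ j → h j x) +_) (sum-sumOver-comm n h xs))

  length-cartesianProductWith : ∀ {a b c} {A : Set a} {B : Set b} {C : Set c} (f : A → B → C) xs ys →
    length (cartesianProductWith f xs ys) ≡ length xs * length ys
  length-cartesianProductWith f []       ys = refl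
  length-cartesianProductWith f (x ∷ xs) ys = trans (length-++ (map (f x) ys))
    (cong₂ _+_ (length-map (f x) ys) (length-cartesianProductWith f xs ys))

  n*m≤sum : ∀ n {m} (f : Fin n → ℕ) → (∀ j → m ≤ f j) → n * m ≤ sum f
  n*m≤sum zero    f m≤f = z≤n
  n*m≤sum (suc n) f m≤f = +-mono-≤ (m≤f zero) (n*m≤sum n (tail f) (m≤f ∘ suc))

  indicator : ∀ {p} {P : Set p} → Dec P → ℕ
  indicator (yes _) = 1
  indicator (no  _) = 0

  indicator≤1 : ∀ {p} {P : Set p} (P? : Dec P) → indicator P? ≤ 1
  indicator≤1 (yes _) = s≤s z≤n
  indicator≤1 (no  _) = z≤n

  indicator-yes : ∀ {p} {P : Set p} (P? : Dec P) → P → indicator P? ≡ 1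
  indicator-yes (yes _) _ = refl
  indicator-yes (no ¬p) p = ⊥-elim (¬p p)

  indicator-no : ∀ {p} {P : Set p} (P? : Dec P) → ¬ P → indicator P? ≡ 0
  indicator-no (yes p) ¬p = ⊥-elim (¬p p)
  indicator-no (no  _) _  = refl

  sum-indicator≤indicator : ∀ {p q} {P : Set p} n {Q : Fin n → Set q} (Q? : ∀ j → Dec (Q j)) (P? : Dec P) →
    (∀ j → Q j → P) → (∀ j j′ → Q j → Q j′ → j ≡ j′) → sum (λ j → indicator (Q? j)) ≤ indicator P?
  sum-indicator≤indicator zero    Q? P? Q⇒P unique = z≤n
  sum-indicator≤indicator (suc n) Q? P? Q⇒P unique with Q? zero
  ... | yes q₀ = ≤-reflexive (begin-equality
    1 + sum (λ j → indicator (Q? (suc j)))  ≡⟨ cong suc (trans (sum-cong-≗ others-fail) (sum-replicate-zero n)) ⟩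
    1                                       ≡⟨ indicator-yes P? (Q⇒P zero q₀) ⟨
    indicator P?                            ∎)
    where
      others-fail : ∀ j → indicator (Q? (suc j)) ≡ 0
      others-fail j = indicator-no (Q? (suc j)) (λ qⱼ → Finₚ.0≢1+n (unique zero (suc j) q₀ qⱼ))
      open ≤-Reasoning
  ... | no  _  = sum-indicator≤indicator n (Q? ∘ suc) P? (Q⇒P ∘ suc) (λ j j′ q q′ → Finₚ.suc-injective (unique (suc j) (suc j′) q q′))

  module _ {a p} {A : Set a} {P : A → Set p} (P? : ∀ x → Dec (P x)) where

    count : List A → ℕ
    count = sumOver (indicator ∘ P?)

    length-filter≡count : ∀ xs → length (filter P? xs) ≡ count xs
    length-filter≡count []       = refl
    length-filter≡count (x ∷ xs) with P? x
    ... | yes _ = cong suc (length-filter≡count xs)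
    ... | no  _ = length-filter≡count xs

    count+count¬≡length : ∀ xs → count xs + sumOver (indicator ∘ ¬? ∘ P?) xs ≡ length xs
    count+count¬≡length []       = refl
    count+count¬≡length (x ∷ xs) with P? x
    ... | yes _ = cong suc (count+count¬≡length xs)
    ... | no  _ = trans (+-suc _ _) (cong suc (count+count¬≡length xs))

  count-∖ : ∀ {a p₁ p₂} {A : Set a} {P₁ : A → Set p₁} {P₂ : A → Set p₂} (P₁? : ∀ x → Dec (P₁ x)) (P₂? : ∀ x → Dec (P₂ x)) →
    (∀ x → P₂ x → P₁ x) → ∀ xs → count (λ x → P₁? x ×-dec ¬? (P₂? x)) xs ≡ count P₁? xs ∸ count P₂? xs
  count-∖ P₁? P₂? P₂⊆P₁ xs = sym (trans
    (cong (_∸ count P₂? xs) (trans (sumOver-cong xs split) (sumOver-+ _ _ xs)))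
    (m+n∸n≡m _ (count P₂? xs)))
    where
      split : ∀ x → indicator (P₁? x) ≡ indicator (P₁? x ×-dec ¬? (P₂? x)) + indicator (P₂? x)
      split x with P₁? x | P₂? x
      ... | yes _  | yes _  = refl
      ... | yes _  | no  _  = refl
      ... | no ¬p₁ | yes p₂ = ⊥-elim (¬p₁ (P₂⊆P₁ x p₂))
      ... | no  _  | no  _  = refl

  module _ {c ℓ} (S : Setoid c ℓ) where
    open Setoid S using (_≈_) renaming (Carrier to A; sym to ≈-sym; trans to ≈-trans)
    open Membership S using (_∈_)
    open Unique S using (Unique)

    count≡0⇒∉ : ∀ {p} {P : A → Set p} (P? : ∀ x → Dec (P x)) → (∀ {x y} → x ≈ y → P x → P y) →
      ∀ xs → count P? xs ≡ 0 → ∀ {x} → x ∈ xs → ¬ P x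
    count≡0⇒∉ P? resp (y ∷ ys) count≡0 (here x≈y) px with P? y
    ... | yes _  = 1+n≢0 count≡0
    ... | no ¬py = ¬py (resp x≈y px)
    count≡0⇒∉ P? resp (y ∷ ys) count≡0 (there x∈ys) px with P? y
    ... | yes _ = 1+n≢0 count≡0
    ... | no  _ = count≡0⇒∉ P? resp ys count≡0 x∈ys px

    private
      remove : ∀ {y} zs → y ∈ zs → Σ (List A) λ zs′ → length zs ≡ suc (length zs′) × (∀ {w} → w ∈ zs → ¬ w ≈ y → w ∈ zs′)
      remove (z ∷ zs) (here y≈z) = zs , refl , λ { (here w≈z) w≉y → ⊥-elim (w≉y (≈-trans w≈z (≈-sym y≈z))) ; (there w∈zs) _ → w∈zs }
      remove (z ∷ zs) (there y∈zs) with remove zs y∈zs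
      ... | zs′ , |zs|≡ , keep = z ∷ zs′ , cong suc |zs|≡ , λ { (here w≈z) _ → here w≈z ; (there w∈zs) w≉y → there (keep w∈zs w≉y) }

    unique⊆⇒length≤ : ∀ {ys zs} → Unique ys → All (_∈ zs) ys → length ys ≤ length zs
    unique⊆⇒length≤ {[]}     _ _ = z≤n
    unique⊆⇒length≤ {y ∷ ys} {zs} (y≉ys ∷ ys!) (y∈zs ∷ ys⊆zs) with remove zs y∈zs
    ... | zs′ , |zs|≡ , keep = subst (suc (length ys) ≤_) (sym |zs|≡)
      (s≤s (unique⊆⇒length≤ ys! (All.zipWith (λ (y≉w , w∈zs) → keep w∈zs (y≉w ∘ ≈-sym)) (y≉ys , ys⊆zs))))

module LinearAlgebra {c ℓ : Level} {q : ℕ} (𝔽 : FiniteField c ℓ q) where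
  open import Level using (_⊔_; Lift; lift)
  open import Data.Nat.Base as ℕ using (zero; suc)
  open import Data.Fin.Base using (Fin; zero; suc; splitAt; _↑ˡ_; _↑ʳ_)
  import Data.Fin.Properties as Finₚ
  open import Data.List.Base as List using (List)
  open import Data.List.Relation.Unary.Any as Any using (Any; here)
  open import Data.List.Relation.Unary.AllPairs as AllPairs using ()
  open import Data.List.Relation.Unary.All as All using ()
  import Data.List.Membership.Setoid.Properties as Membershipₚ
  import Data.List.Relation.Unary.Unique.Setoid as Unique
  import Data.List.Relation.Unary.Unique.Setoid.Properties as Uniqueₚ
  open import Data.Product.Base using (Σ; _×_; _,_; proj₁; proj₂)
  open import Data.Sum.Properties using ([,]-map)
  open import Data.Unit.Base using (⊤; tt)
  open import Data.Empty using (⊥-elim)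
  open import Data.Vec.Functional using ([]; _∷_; head; tail; _++_)
  open import Data.Vec.Functional.Properties using (lookup-++ʳ)
  open import Function.Base using (_∘_)
  open import Relation.Nullary using (¬_; Dec; yes; no)
  import Relation.Nullary.Decidable as Dec
  open import Relation.Nullary.Decidable using (_×-dec_; ¬?)
  open import Relation.Binary.PropositionalEquality as ≡ using (_≡_)
  open FiniteField 𝔽 hiding (zero)
  open Geometry 𝔽
  open import Algebra.Properties.Ring ring using (-1*x≈-x)
  open import Algebra.Properties.Group +-group using (x∙y⁻¹≈ε⇒x≈y; x≈y⇒x∙y⁻¹≈ε)
  open import Algebra.Properties.AbelianGroup +-abelianGroup using (⁻¹-∙-comm)
  open import Algebra.Solver.Ring.NaturalCoefficients.Default commutativeSemiring
  open import Data.Vec.Functional.Relation.Binary.Equality.Setoid setoid public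
    using (≋-refl; ≋-reflexive; ≋-sym; ≋-trans; ≋-setoid)
  open import Relation.Binary.Reasoning.Setoid setoid

  _≈?_ : (x y : Carrier) → Dec (x ≈ y)
  x ≈? y with enum-surj x | enum-surj y
  ... | i , i≈x | j , j≈y =
    Dec.map′ (λ i≡j → trans (sym i≈x) (trans (reflexive (≡.cong enum i≡j)) j≈y))
             (λ x≈y → enum-inj i j (trans i≈x (trans x≈y (sym j≈y))))
             (i Finₚ.≟ j)

  _≈ᵥ?_ : ∀ {k} (u v : Vec k) → Dec (u ≈ᵥ v)
  u ≈ᵥ? v = Finₚ.all? (λ i → u i ≈? v i)

  +ᵥ-cong : ∀ {k} {u u′ v v′ : Vec k} → u ≈ᵥ u′ → v ≈ᵥ v′ → (u +ᵥ v) ≈ᵥ (u′ +ᵥ v′)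
  +ᵥ-cong u≈u′ v≈v′ i = +-cong (u≈u′ i) (v≈v′ i)

  ·-cong : ∀ {k} {x y} {u v : Vec k} → x ≈ y → u ≈ᵥ v → (x · u) ≈ᵥ (y · v)
  ·-cong x≈y u≈v i = *-cong x≈y (u≈v i)

  left-inverse : ∀ {x} → ¬ x ≈ 0# → Σ Carrier λ z → z * x ≈ 1#
  left-inverse {x} x≉0 = proj₁ (inverse x x≉0) , trans (*-comm _ x) (proj₂ (inverse x x≉0))

  isolate : ∀ {z a b L} → z * a ≈ 1# → z * (a * b + L) + - z * L ≈ b
  isolate {z} {a} {b} {L} za≈1 = begin
    z * (a * b + L) + - z * L      ≈⟨ solve 5 (λ z a b L z′ → z :* (a :* b :+ L) :+ z′ :* L := z :* a :* b :+ (z :+ z′) :* L) refl z a b L (- z) ⟩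
    z * a * b + (z + - z) * L      ≈⟨ +-cong (*-congʳ za≈1) (*-congʳ (-‿inverseʳ z)) ⟩
    1# * b + 0# * L                ≈⟨ +-cong (*-identityˡ b) (zeroˡ L) ⟩
    b + 0#                         ≈⟨ +-identityʳ b ⟩
    b                              ∎

  elements : List Carrier
  elements = List.tabulate enum

  ∈-elements : ∀ x → Any (x ≈_) elements
  ∈-elements x = Membershipₚ.∈-resp-≈ setoid (proj₂ (enum-surj x)) (Membershipₚ.∈-tabulate⁺ setoid (proj₁ (enum-surj x)))

  vectors : ∀ m → List (Vec m)
  vectors zero    = List.[ [] ]
  vectors (suc m) = List.cartesianProductWith _∷_ elements (vectors m)

  ∈-vectors : ∀ {m} (v : Vec m) → Any (v ≈ᵥ_) (vectors m)
  ∈-vectors {zero}  v = here (λ ())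
  ∈-vectors {suc m} v = Membershipₚ.∈-resp-≈ (≋-setoid (suc m)) head∷tail≈v
    (Membershipₚ.∈-cartesianProductWith⁺ setoid (≋-setoid m) (≋-setoid (suc m)) ∷-cong (∈-elements (head v)) (∈-vectors (tail v)))
    where
      head∷tail≈v : (head v ∷ tail v) ≈ᵥ v
      head∷tail≈v zero    = refl
      head∷tail≈v (suc i) = refl
      ∷-cong : ∀ {x y} {u w : Vec m} → x ≈ y → u ≈ᵥ w → (x ∷ u) ≈ᵥ (y ∷ w)
      ∷-cong x≈y u≈w zero    = x≈y
      ∷-cong x≈y u≈w (suc i) = u≈w i

  vectors-unique : ∀ m → Unique.Unique (≋-setoid m) (vectors m)
  vectors-unique zero    = All.[] AllPairs.∷ AllPairs.[]
  vectors-unique (suc m) = Uniqueₚ.cartesianProductWith⁺ setoid (≋-setoid m) (≋-setoid (suc m)) _∷_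
    (λ x∷u≈y∷w → x∷u≈y∷w zero , x∷u≈y∷w ∘ suc)
    (Uniqueₚ.tabulate⁺ setoid (enum-inj _ _)) (vectors-unique m)

  Σ-vector? : ∀ {p} d {P : Vec d → Set p} → (∀ a → Dec (P a)) → (∀ {a a′} → a ≈ᵥ a′ → P a → P a′) → Dec (Σ (Vec d) P)
  Σ-vector? d P? resp-P with Any.any? P? (vectors d)
  ... | yes p = yes (Any.satisfied p)
  ... | no ¬p = no λ (a , pa) → ¬p (Any.map (λ a≈v → resp-P a≈v pa) (∈-vectors a))

  module _ {k : ℕ} where

    lincomb-congˡ : ∀ d {a a′ : Vec d} (b : Fin d → Vec k) → a ≈ᵥ a′ → lincomb d a b ≈ᵥ lincomb d a′ b
    lincomb-congˡ zero    b a≈a′ = ≋-refl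
    lincomb-congˡ (suc d) b a≈a′ = +ᵥ-cong (·-cong (a≈a′ zero) ≋-refl) (lincomb-congˡ d (tail b) (a≈a′ ∘ suc))

    lincomb-0 : ∀ d (b : Fin d → Vec k) → lincomb d 0ᵥ b ≈ᵥ 0ᵥ
    lincomb-0 zero    b = ≋-refl
    lincomb-0 (suc d) b i = trans (+-cong (zeroˡ _) (lincomb-0 d (tail b) i)) (+-identityʳ 0#)

    lincomb-+ : ∀ d (a a′ : Vec d) (b : Fin d → Vec k) → lincomb d (a +ᵥ a′) b ≈ᵥ (lincomb d a b +ᵥ lincomb d a′ b)
    lincomb-+ zero    a a′ b i = sym (+-identityʳ 0#)
    lincomb-+ (suc d) a a′ b i = begin
      (head a + head a′) * head b i + lincomb d (tail a +ᵥ tail a′) (tail b) i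
        ≈⟨ +-cong refl (lincomb-+ d (tail a) (tail a′) (tail b) i) ⟩
      (head a + head a′) * head b i + (L i + L′ i)
        ≈⟨ solve 5 (λ x y z X Y → (x :+ y) :* z :+ (X :+ Y) := (x :* z :+ X) :+ (y :* z :+ Y)) refl (head a) (head a′) (head b i) (L i) (L′ i) ⟩
      (head a * head b i + L i) + (head a′ * head b i + L′ i) ∎
      where L = lincomb d (tail a) (tail b); L′ = lincomb d (tail a′) (tail b)

    lincomb-· : ∀ d x (a : Vec d) (b : Fin d → Vec k) → lincomb d (x · a) b ≈ᵥ (x · lincomb d a b)
    lincomb-· zero    x a b i = sym (zeroʳ x)
    lincomb-· (suc d) x a b i = begin
      x * head a * head b i + lincomb d (x · tail a) (tail b) i  ≈⟨ +-cong refl (lincomb-· d x (tail a) (tail b) i) ⟩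
      x * head a * head b i + x * L i                            ≈⟨ solve 4 (λ x y z X → x :* y :* z :+ x :* X := x :* (y :* z :+ X)) refl x (head a) (head b i) (L i) ⟩
      x * (head a * head b i + L i)                              ∎
      where L = lincomb d (tail a) (tail b)

    lincomb-- : ∀ d (a a′ : Vec d) (b : Fin d → Vec k) → lincomb d (a -ᵥ a′) b ≈ᵥ (lincomb d a b -ᵥ lincomb d a′ b)
    lincomb-- d a a′ b i = begin
      lincomb d (a -ᵥ a′) b i                   ≈⟨ lincomb-congˡ d b (λ j → +-cong refl (sym (-1*x≈-x (a′ j)))) i ⟩
      lincomb d (a +ᵥ ((- 1#) · a′)) b i          ≈⟨ lincomb-+ d a _ b i ⟩
      lincomb d a b i + lincomb d ((- 1#) · a′) b i ≈⟨ +-cong refl (trans (lincomb-· d (- 1#) a′ b i) (-1*x≈-x _)) ⟩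
      lincomb d a b i + - lincomb d a′ b i      ∎

    lincomb-congʳ : ∀ d (a : Vec d) {b b′ : Fin d → Vec k} → (∀ j → b j ≈ᵥ b′ j) → lincomb d a b ≈ᵥ lincomb d a b′
    lincomb-congʳ zero    a b≈b′ = ≋-refl
    lincomb-congʳ (suc d) a b≈b′ = +ᵥ-cong (·-cong refl (b≈b′ zero)) (lincomb-congʳ d (tail a) (b≈b′ ∘ suc))

    lincomb-++ : ∀ d e (a : Vec (d ℕ.+ e)) (b : Fin d → Vec k) (b′ : Fin e → Vec k) →
      lincomb (d ℕ.+ e) a (b ++ b′) ≈ᵥ (lincomb d (a ∘ (_↑ˡ e)) b +ᵥ lincomb e (a ∘ (d ↑ʳ_)) b′)
    lincomb-++ zero    e a b b′ i = sym (+-identityˡ _)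
    lincomb-++ (suc d) e a b b′ i = begin
      head a * b zero i + lincomb (d ℕ.+ e) (tail a) (tail (b ++ b′)) i
        ≈⟨ +-cong refl (lincomb-congʳ (d ℕ.+ e) (tail a) (λ j → ≋-reflexive ([,]-map (splitAt d j))) i) ⟩
      head a * b zero i + lincomb (d ℕ.+ e) (tail a) (tail b ++ b′) i
        ≈⟨ +-cong refl (lincomb-++ d e (tail a) (tail b) b′ i) ⟩
      head a * b zero i + (lincomb d (tail a ∘ (_↑ˡ e)) (tail b) i + lincomb e (tail a ∘ (d ↑ʳ_)) b′ i)
        ≈⟨ +-assoc _ _ _ ⟨
      head a * b zero i + lincomb d (tail a ∘ (_↑ˡ e)) (tail b) i + lincomb e (tail a ∘ (d ↑ʳ_)) b′ i ∎

    infix 4 _∈⟨_⟩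
    _∈⟨_⟩ : ∀ {d} → Vec k → (Fin d → Vec k) → Set (c ⊔ ℓ)
    _∈⟨_⟩ {d} x b = Σ (Vec d) λ a → x ≈ᵥ lincomb d a b

    ⟨_⟩ : ∀ {d} → (Fin d → Vec k) → Subspace k
    ⟨_⟩ {d} b = record
      { _∈S   = _∈⟨ b ⟩
      ; resp  = λ { u≈v (a , u≈ab) → a , ≋-trans (≋-sym u≈v) u≈ab }
      ; zero∈ = 0ᵥ , ≋-sym (lincomb-0 d b)
      ; +∈    = λ { (a , u≈ab) (a′ , v≈a′b) → a +ᵥ a′ , ≋-trans (+ᵥ-cong u≈ab v≈a′b) (≋-sym (lincomb-+ d a a′ b)) }
      ; ·∈    = λ { x (a , v≈ab) → x · a , ≋-trans (·-cong refl v≈ab) (≋-sym (lincomb-· d x a b)) }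
      }

    lincomb-∈ : ∀ (W : Subspace k) d {b : Fin d → Vec k} → (∀ j → (W ∈S) (b j)) → ∀ a → (W ∈S) (lincomb d a b)
    lincomb-∈ W zero    b∈W a = zero∈ W
    lincomb-∈ W (suc d) b∈W a = +∈ W (·∈ W (head a) (b∈W zero)) (lincomb-∈ W d (b∈W ∘ suc) (tail a))

    ⟨⟩-least : ∀ (W : Subspace k) {d} {b : Fin d → Vec k} → (∀ j → (W ∈S) (b j)) → ∀ {x} → x ∈⟨ b ⟩ → (W ∈S) x
    ⟨⟩-least W b∈W (a , x≈ab) = resp W (≋-sym x≈ab) (lincomb-∈ W _ b∈W a)

    ⟨⟩-mono : ∀ {d e} {b : Fin d → Vec k} {b′ : Fin e → Vec k} → (∀ j → b j ∈⟨ b′ ⟩) → ∀ {x} → x ∈⟨ b ⟩ → x ∈⟨ b′ ⟩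
    ⟨⟩-mono {b′ = b′} = ⟨⟩-least ⟨ b′ ⟩

    ∈⟨tail⟩⇒∈⟨⟩ : ∀ {d} {b : Fin (suc d) → Vec k} {x} → x ∈⟨ tail b ⟩ → x ∈⟨ b ⟩
    ∈⟨tail⟩⇒∈⟨⟩ (a , x≈ab) = 0# ∷ a , λ i → trans (x≈ab i) (sym (trans (+-cong (zeroˡ _) refl) (+-identityˡ _)))

    generator-∈⟨⟩ : ∀ {d} (b : Fin d → Vec k) j → b j ∈⟨ b ⟩
    generator-∈⟨⟩ {suc d} b zero    = 1# ∷ 0ᵥ , λ i → sym (trans (+-cong (*-identityˡ _) (lincomb-0 d (tail b) i)) (+-identityʳ _))
    generator-∈⟨⟩ {suc d} b (suc j) = ∈⟨tail⟩⇒∈⟨⟩ {b = b} (generator-∈⟨⟩ (tail b) j)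

    ∈⟨⟩-++ʳ : ∀ {d e} (b : Fin d → Vec k) {b′ : Fin e → Vec k} {x} → x ∈⟨ b′ ⟩ → x ∈⟨ b ++ b′ ⟩
    ∈⟨⟩-++ʳ {d} b {b′} = ⟨⟩-mono {b = b′} (λ j → ≡.subst (_∈⟨ b ++ b′ ⟩) (lookup-++ʳ b b′ j) (generator-∈⟨⟩ (b ++ b′) (d ↑ʳ j)))

    ∈⟨⟩-∷-++ : ∀ {d e} v (b : Fin d → Vec k) {b′ : Fin e → Vec k} {x} → x ∈⟨ b ++ b′ ⟩ → x ∈⟨ (v ∷ b) ++ b′ ⟩
    ∈⟨⟩-∷-++ {d} v b {b′} = ⟨⟩-mono {b = b ++ b′} {b′ = (v ∷ b) ++ b′}
      (λ j → ≡.subst (_∈⟨ (v ∷ b) ++ b′ ⟩) ([,]-map (splitAt d j)) (generator-∈⟨⟩ ((v ∷ b) ++ b′) (suc j)))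

    Independent : ∀ {d} → (Fin d → Vec k) → Set (c ⊔ ℓ)
    Independent {zero}  b = Lift (c ⊔ ℓ) ⊤
    Independent {suc d} b = ¬ head b ∈⟨ tail b ⟩ × Independent (tail b)

    Independent⇒LinearlyIndependent : ∀ {d} {b : Fin d → Vec k} → Independent b → LinearlyIndependent d b
    Independent⇒LinearlyIndependent {suc d} {b} (b₀∉ , independent) a ab≈0 with head a ≈? 0#
    ... | yes a₀≈0 = λ { zero → a₀≈0 ; (suc j) → Independent⇒LinearlyIndependent independent (tail a) L≈0 j }
      where
        L≈0 : lincomb d (tail a) (tail b) ≈ᵥ 0ᵥ
        L≈0 i = begin
          lincomb d (tail a) (tail b) i                          ≈⟨ +-identityˡ _ ⟨
          0# + lincomb d (tail a) (tail b) i                     ≈⟨ +-cong (trans (*-congʳ a₀≈0) (zeroˡ _)) refl ⟨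
          head a * head b i + lincomb d (tail a) (tail b) i      ≈⟨ ab≈0 i ⟩
          0#                                                     ∎
    ... | no a₀≉0 = ⊥-elim (b₀∉ ((- z) · tail a , λ i → begin
          head b i                                               ≈⟨ isolate za₀≈1 ⟨
          z * (head a * head b i + L i) + - z * L i              ≈⟨ +-cong (trans (*-congˡ (ab≈0 i)) (zeroʳ z)) refl ⟩
          0# + - z * L i                                         ≈⟨ +-identityˡ _ ⟩
          - z * L i                                              ≈⟨ lincomb-· d (- z) (tail a) (tail b) i ⟨
          lincomb d ((- z) · tail a) (tail b) i                  ∎))
      where
        L = lincomb d (tail a) (tail b)
        z = proj₁ (left-inverse a₀≉0)
        za₀≈1 = proj₂ (left-inverse a₀≉0)

    LinearlyIndependent⇒Independent : ∀ {d} {b : Fin d → Vec k} → LinearlyIndependent d b → Independent b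
    LinearlyIndependent⇒Independent {zero}      _  = lift tt
    LinearlyIndependent⇒Independent {suc d} {b} li = b₀∉ , LinearlyIndependent⇒Independent tail-li
      where
        b₀∉ : ¬ head b ∈⟨ tail b ⟩
        b₀∉ (a , b₀≈ab) = 0≉1 (x∙y⁻¹≈ε⇒x≈y 0# 1# (trans (+-identityˡ (- 1#)) (li ((- 1#) ∷ a) kill zero)))
          where
            kill : lincomb (suc d) ((- 1#) ∷ a) b ≈ᵥ 0ᵥ
            kill i = trans (+-cong (trans (*-congˡ (b₀≈ab i)) (-1*x≈-x _)) refl) (-‿inverseˡ _)
        tail-li : LinearlyIndependent d (tail b)
        tail-li a ab≈0 j = li (0# ∷ a) (λ i → trans (+-cong (zeroˡ _) (ab≈0 i)) (+-identityˡ 0#)) (suc j)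

    lincomb-injective : ∀ {d} {b : Fin d → Vec k} → Independent b → ∀ {a a′} → lincomb d a b ≈ᵥ lincomb d a′ b → a ≈ᵥ a′
    lincomb-injective {d} {b} independent {a} {a′} ab≈a′b j = x∙y⁻¹≈ε⇒x≈y _ _
      (Independent⇒LinearlyIndependent independent (a -ᵥ a′) (λ i → trans (lincomb-- d a a′ b i) (x≈y⇒x∙y⁻¹≈ε (ab≈a′b i))) j)

    exchange : ∀ {d x y} {B : Fin d → Vec k} → y ∈⟨ x ∷ B ⟩ → ¬ y ∈⟨ B ⟩ → x ∈⟨ y ∷ B ⟩
    exchange {d} {x} {y} {B} (a , y≈ax+L) y∉⟨B⟩ with head a ≈? 0#
    ... | yes a₀≈0 = ⊥-elim (y∉⟨B⟩ (tail a , λ i → trans (y≈ax+L i) (trans (+-cong (trans (*-congʳ a₀≈0) (zeroˡ _)) refl) (+-identityˡ _))))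
    ... | no  a₀≉0 = z ∷ ((- z) · tail a) , λ i → sym (begin
          z * y i + lincomb d ((- z) · tail a) B i   ≈⟨ +-cong (*-congˡ (y≈ax+L i)) (lincomb-· d (- z) (tail a) B i) ⟩
          z * (head a * x i + L i) + - z * L i       ≈⟨ isolate za₀≈1 ⟩
          x i                                        ∎)
      where
        L = lincomb d (tail a) B
        z = proj₁ (left-inverse a₀≉0)
        za₀≈1 = proj₂ (left-inverse a₀≉0)

    infix 4 _∈⟨_⟩?
    _∈⟨_⟩? : ∀ {d} x (b : Fin d → Vec k) → Dec (x ∈⟨ b ⟩)
    _∈⟨_⟩? {d} x b = Σ-vector? d (λ a → x ≈ᵥ? lincomb d a b) (λ a≈a′ x≈ab → ≋-trans x≈ab (lincomb-congˡ d b a≈a′))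

    independent? : ∀ {d} (b : Fin d → Vec k) → Dec (Independent b)
    independent? {zero}  b = yes (lift tt)
    independent? {suc d} b = ¬? (head b ∈⟨ tail b ⟩?) ×-dec independent? (tail b)

    x-[x+y]≈-1·y : ∀ (x y : Vec k) → (x -ᵥ (x +ᵥ y)) ≈ᵥ ((- 1#) · y)
    x-[x+y]≈-1·y x y i = begin
      x i + - (x i + y i)     ≈⟨ +-cong refl (⁻¹-∙-comm (x i) (y i)) ⟨
      x i + (- x i + - y i)   ≈⟨ +-assoc _ _ _ ⟨
      x i + - x i + - y i     ≈⟨ +-cong (-‿inverseʳ (x i)) refl ⟩
      0# + - y i              ≈⟨ +-identityˡ _ ⟩
      - y i                   ≈⟨ -1*x≈-x (y i) ⟨
      - 1# * y i              ∎

    point≈x+y⇒x∈A : ∀ (H : AffineSubspace k) {x y} → AffineSubspace.point H ≈ᵥ (x +ᵥ y) →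
      (AffineSubspace.direction H ∈S) y → x ∈A H
    point≈x+y⇒x∈A H {x} {y} p≈x+y y∈dir = resp dir
      (λ i → sym (trans (+-cong refl (-‿cong (p≈x+y i))) (x-[x+y]≈-1·y x y i))) (·∈ dir (- 1#) y∈dir)
      where dir = AffineSubspace.direction H

    Disjoint⇒point∉⟨⟩ : ∀ (H : AffineSubspace k) (W : Subspace k) {s dh} {t : Fin s → Vec k} {hb : Fin dh → Vec k} →
      Disjoint W H → (∀ m → (W ∈S) (t m)) → (∀ j → (AffineSubspace.direction H ∈S) (hb j)) →
      ¬ AffineSubspace.point H ∈⟨ t ++ hb ⟩
    Disjoint⇒point∉⟨⟩ H W {s} {dh} {t} {hb} W∩H≡∅ t⊆W hb⊆dir (a , p≈) = W∩H≡∅ _ (lincomb-∈ W s t⊆W _)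
      (point≈x+y⇒x∈A H (≋-trans p≈ (lincomb-++ s dh a t hb)) (lincomb-∈ (AffineSubspace.direction H) dh hb⊆dir _))

    point∈direction⇒0∈A : ∀ (H : AffineSubspace k) → (AffineSubspace.direction H ∈S) (AffineSubspace.point H) → 0ᵥ ∈A H
    point∈direction⇒0∈A H = point≈x+y⇒x∈A H (λ i → sym (+-identityˡ _))

module FrameCounting {c ℓ : Level} {q : ℕ} (𝔽 : FiniteField c ℓ q) where
  open FrameArithmetic using (frameCount; disjointFrameBound; m≡n+o⇒m∸n≡o)
  open Counting
  open import Level using (_⊔_; lift)
  open import Data.Unit.Base using (tt)
  open import Data.Nat.Base hiding (_⊔_)
  open import Data.Nat.Properties
  open import Data.Fin.Base using (Fin; zero; suc)
  import Data.Fin.Properties as Finₚ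
  open import Algebra.Properties.CommutativeMonoid.Sum +-0-commutativeMonoid using (sum)
  open import Data.List.Base using (length; filter; map)
  open import Data.List.Properties using (length-map; length-tabulate)
  import Data.List.Relation.Unary.All as All
  import Data.List.Relation.Unary.All.Properties as Allₚ
  open import Data.List.Relation.Unary.Any using (Any)
  import Data.List.Membership.Setoid.Properties as Membershipₚ
  import Data.List.Relation.Unary.Unique.Setoid.Properties as Uniqueₚ
  open import Data.Product.Base using (_×_; _,_; proj₁; proj₂)
  open import Data.Sum.Base using (_⊎_; inj₁; inj₂)
  open import Data.Empty using (⊥-elim)
  open import Data.Vec.Functional using ([]; _∷_; _++_)
  open import Function.Base using (_∘_)
  open import Function.Bundles using (mk⇔)
  open import Relation.Nullary using (¬_; Dec; yes; no)
  open import Relation.Nullary.Decidable using (_×-dec_; ¬?)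
  open import Relation.Binary.PropositionalEquality using (_≡_; refl; sym; trans; cong; cong₂; subst)
  open FiniteField 𝔽 using (Carrier; enum; setoid)
  open Geometry 𝔽
  open LinearAlgebra 𝔽

  vectors-length : ∀ m → length (vectors m) ≡ q ^ m
  vectors-length zero    = refl
  vectors-length (suc m) = trans (length-cartesianProductWith _∷_ elements (vectors m))
                                 (cong₂ _*_ (length-tabulate enum) (vectors-length m))

  module _ {k : ℕ} where

    size : ∀ {p} {P : Vec k → Set p} → (∀ v → Dec (P v)) → ℕ
    size P? = count P? (vectors k)

    size-⟨⟩≤ : ∀ {d} (b : Fin d → Vec k) → size (_∈⟨ b ⟩?) ≤ q ^ d
    size-⟨⟩≤ {d} b = begin
      size (_∈⟨ b ⟩?)                                 ≡⟨ length-filter≡count (_∈⟨ b ⟩?) (vectors k) ⟨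
      length (filter (_∈⟨ b ⟩?) (vectors k))          ≤⟨ unique⊆⇒length≤ (≋-setoid k) filter-unique in-image ⟩
      length (map (λ a → lincomb d a b) (vectors d))  ≡⟨ length-map _ (vectors d) ⟩
      length (vectors d)                              ≡⟨ vectors-length d ⟩
      q ^ d                                           ∎
      where
        open ≤-Reasoning
        filter-unique = Uniqueₚ.filter⁺ (≋-setoid k) (_∈⟨ b ⟩?) (vectors-unique k)
        in-image : All.All (λ x → Any (x ≈ᵥ_) (map (λ a → lincomb d a b) (vectors d))) (filter (_∈⟨ b ⟩?) (vectors k))
        in-image = All.map (λ (a , x≈ab) → Membershipₚ.∈-resp-≈ (≋-setoid k) (≋-sym x≈ab)
                                             (Membershipₚ.∈-map⁺ (≋-setoid d) (≋-setoid k) (lincomb-congˡ d b) (∈-vectors a)))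
                           (Allₚ.all-filter (_∈⟨ b ⟩?) (vectors k))

    size-⟨⟩≥ : ∀ {d} {b : Fin d → Vec k} → Independent b → q ^ d ≤ size (_∈⟨ b ⟩?)
    size-⟨⟩≥ {d} {b} independent = begin
      q ^ d                                           ≡⟨ vectors-length d ⟨
      length (vectors d)                              ≡⟨ length-map _ (vectors d) ⟨
      length (map (λ a → lincomb d a b) (vectors d))  ≤⟨ unique⊆⇒length≤ (≋-setoid k) image-unique in-span ⟩
      length (filter (_∈⟨ b ⟩?) (vectors k))          ≡⟨ length-filter≡count (_∈⟨ b ⟩?) (vectors k) ⟩
      size (_∈⟨ b ⟩?)                                 ∎
      where
        open ≤-Reasoning
        image-unique = Uniqueₚ.map⁺ (≋-setoid d) (≋-setoid k) (lincomb-injective independent) (vectors-unique d)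
        in-span : All.All (λ x → Any (x ≈ᵥ_) (filter (_∈⟨ b ⟩?) (vectors k))) (map (λ a → lincomb d a b) (vectors d))
        in-span = Allₚ.map⁺ (All.universal (λ a → Membershipₚ.∈-filter⁺ (≋-setoid k) (_∈⟨ b ⟩?) (resp ⟨ b ⟩)
                                                      (∈-vectors (lincomb d a b)) (a , ≋-refl))
                                            (vectors d))

    ⟨⟩⊆⟨independent⟩ : ∀ {s} {B t : Fin s → Vec k} → Independent t → (∀ j → t j ∈⟨ B ⟩) → ∀ {x} → x ∈⟨ B ⟩ → x ∈⟨ t ⟩
    ⟨⟩⊆⟨independent⟩ {s} {B} {t} independent t⊆⟨B⟩ {x} x∈⟨B⟩ with x ∈⟨ t ⟩?
    ... | yes x∈⟨t⟩ = x∈⟨t⟩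
    ... | no  x∉⟨t⟩ = ⊥-elim (count≡0⇒∉ (≋-setoid k) Outside? resp-Outside (vectors k) size≡0 (∈-vectors x) (x∈⟨B⟩ , x∉⟨t⟩))
      where
        Outside? = λ v → v ∈⟨ B ⟩? ×-dec ¬? (v ∈⟨ t ⟩?)
        resp-Outside : ∀ {u v} → u ≈ᵥ v → u ∈⟨ B ⟩ × ¬ u ∈⟨ t ⟩ → v ∈⟨ B ⟩ × ¬ v ∈⟨ t ⟩
        resp-Outside u≈v (u∈ , u∉) = resp ⟨ B ⟩ u≈v u∈ , u∉ ∘ resp ⟨ t ⟩ (≋-sym u≈v)
        size≡0 : size Outside? ≡ 0
        size≡0 = n≤0⇒n≡0 (begin
          size Outside?                           ≡⟨ count-∖ (_∈⟨ B ⟩?) (_∈⟨ t ⟩?) (λ _ → ⟨⟩-mono t⊆⟨B⟩) (vectors k) ⟩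
          size (_∈⟨ B ⟩?) ∸ size (_∈⟨ t ⟩?)      ≤⟨ ∸-mono (size-⟨⟩≤ B) (size-⟨⟩≥ independent) ⟩
          q ^ s ∸ q ^ s                           ≡⟨ n∸n≡0 (q ^ s) ⟩
          0                                       ∎)
          where open ≤-Reasoning

    ⊆-by-common-frame : ∀ {s} (W W′ : Subspace k) {b b′ t : Fin s → Vec k} →
      (∀ {x} → (W ∈S) x → x ∈⟨ b ⟩) → (∀ m → (W′ ∈S) (b′ m)) →
      Independent t → (∀ m → t m ∈⟨ b ⟩) → (∀ m → t m ∈⟨ b′ ⟩) → ∀ {x} → (W ∈S) x → (W′ ∈S) x
    ⊆-by-common-frame W W′ W⊆⟨b⟩ b′⊆W′ t-independent t⊆⟨b⟩ t⊆⟨b′⟩ x∈W =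
      ⟨⟩-least W′ b′⊆W′ (⟨⟩-mono t⊆⟨b′⟩ (⟨⟩⊆⟨independent⟩ t-independent t⊆⟨b⟩ (W⊆⟨b⟩ x∈W)))

    Weight : Set c
    Weight = ∀ {i} → (Fin i → Vec k) → ℕ

    extensionSum : Weight → ∀ {i} → (Fin i → Vec k) → ℕ → ℕ
    extensionSum w pre zero    = w pre
    extensionSum w pre (suc r) = sumOver (λ v → extensionSum w (v ∷ pre) r) (vectors k)

    extensionSum-vanish : ∀ {b} (w : Weight) (Bad : ∀ {i} → (Fin i → Vec k) → Set b) →
      (∀ {i} {pre : Fin i → Vec k} v → Bad pre → Bad (v ∷ pre)) → (∀ {i} {pre : Fin i → Vec k} → Bad pre → w pre ≡ 0) →
      ∀ r {i} {pre : Fin i → Vec k} → Bad pre → extensionSum w pre r ≡ 0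
    extensionSum-vanish w Bad bad-∷ bad⇒0 zero    bad = bad⇒0 bad
    extensionSum-vanish w Bad bad-∷ bad⇒0 (suc r) bad =
      trans (sumOver-cong (vectors k) (λ v → extensionSum-vanish w Bad bad-∷ bad⇒0 r (bad-∷ v bad))) (sumOver-0 (vectors k))

    sum-extensionSum≤ : ∀ n (w : Fin n → Weight) (w′ : Weight) s → (∀ (t : Fin s → Vec k) → sum (λ j → w j t) ≤ w′ t) →
      ∀ r {i} (pre : Fin i → Vec k) → i + r ≡ s → sum (λ j → extensionSum (w j) pre r) ≤ extensionSum w′ pre r
    sum-extensionSum≤ n w w′ s leaf-bound zero {i} pre i+0≡s with trans (sym (+-identityʳ i)) i+0≡s
    ... | refl = leaf-bound pre
    sum-extensionSum≤ n w w′ s leaf-bound (suc r) {i} pre i+1+r≡s =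
      subst (_≤ extensionSum w′ pre (suc r)) (sym (sum-sumOver-comm n (λ j v → extensionSum (w j) (v ∷ pre) r) (vectors k)))
        (sumOver-mono-≤ (vectors k) (λ v → sum-extensionSum≤ n w w′ s leaf-bound r (v ∷ pre) (trans (sym (+-suc i r)) i+1+r≡s)))

    module InsideSpan {s} (bW : Fin s → Vec k) (bW-independent : Independent bW) where

      Inside : ∀ {i} → (Fin i → Vec k) → Set (c ⊔ ℓ)
      Inside pre = Independent pre × (∀ j → pre j ∈⟨ bW ⟩)

      inside? : ∀ {i} (pre : Fin i → Vec k) → Dec (Inside pre)
      inside? pre = independent? pre ×-dec Finₚ.all? (λ j → pre j ∈⟨ bW ⟩?)

      frameCount≤extensionSum : ∀ r {i} (pre : Fin i → Vec k) → Inside pre →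
        frameCount q s i r ≤ extensionSum (indicator ∘ inside?) pre r
      frameCount≤extensionSum zero    pre inside = ≤-reflexive (sym (indicator-yes (inside? pre) inside))
      frameCount≤extensionSum (suc r) {i} pre (pre-independent , pre⊆⟨bW⟩) = begin
        (q ^ s ∸ q ^ i) * F                                     ≤⟨ *-monoˡ-≤ F new≥ ⟩
        size New? * F                                           ≡⟨ sumOver-*ʳ (indicator ∘ New?) F (vectors k) ⟨
        sumOver (λ v → indicator (New? v) * F) (vectors k)      ≤⟨ sumOver-mono-≤ (vectors k) extend ⟩
        extensionSum (indicator ∘ inside?) pre (suc r)          ∎
        where
          open ≤-Reasoning
          F = frameCount q s (suc i) r
          New? = λ v → v ∈⟨ bW ⟩? ×-dec ¬? (v ∈⟨ pre ⟩?)
          new≥ : q ^ s ∸ q ^ i ≤ size New?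
          new≥ = subst (q ^ s ∸ q ^ i ≤_) (sym (count-∖ (_∈⟨ bW ⟩?) (_∈⟨ pre ⟩?) (λ _ → ⟨⟩-mono pre⊆⟨bW⟩) (vectors k)))
                   (∸-mono (size-⟨⟩≥ bW-independent) (size-⟨⟩≤ pre))
          extend : ∀ v → indicator (New? v) * F ≤ extensionSum (indicator ∘ inside?) (v ∷ pre) r
          extend v with New? v
          ... | yes (v∈⟨bW⟩ , v∉⟨pre⟩) = ≤-trans (≤-reflexive (+-identityʳ F))
                  (frameCount≤extensionSum r (v ∷ pre) ((v∉⟨pre⟩ , pre-independent) , λ { zero → v∈⟨bW⟩ ; (suc j) → pre⊆⟨bW⟩ j }))
          ... | no _ = z≤n

    module AvoidingPoint {dh} (hb : Fin dh → Vec k) (p : Vec k) where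

      -- ⟨pre⟩ is disjoint from p + ⟨hb⟩ iff p ∉ ⟨pre⟩ + ⟨hb⟩.
      Avoiding : ∀ {i} → (Fin i → Vec k) → Set (c ⊔ ℓ)
      Avoiding pre = Independent pre × ¬ p ∈⟨ pre ++ hb ⟩

      avoiding? : ∀ {i} (pre : Fin i → Vec k) → Dec (Avoiding pre)
      avoiding? pre = independent? pre ×-dec ¬? (p ∈⟨ pre ++ hb ⟩?)

      Hopeless : ∀ {i} → (Fin i → Vec k) → Set (c ⊔ ℓ)
      Hopeless pre = ¬ Independent pre ⊎ p ∈⟨ pre ++ hb ⟩

      hopeless⇒extensionSum≡0 : ∀ r {i} {pre : Fin i → Vec k} → Hopeless pre → extensionSum (indicator ∘ avoiding?) pre r ≡ 0
      hopeless⇒extensionSum≡0 = extensionSum-vanish (indicator ∘ avoiding?) Hopeless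
        (λ { v (inj₁ dependent) → inj₁ (dependent ∘ proj₂) ; {pre = pre} v (inj₂ p∈) → inj₂ (∈⟨⟩-∷-++ v pre p∈) })
        (λ { {pre = pre} (inj₁ dependent) → indicator-no (avoiding? pre) (dependent ∘ proj₁)
           ; {pre = pre} (inj₂ p∈)        → indicator-no (avoiding? pre) (λ (_ , p∉) → p∉ p∈) })

      record Invariant {i d} (pre : Fin i → Vec k) (B : Fin d → Vec k) : Set (c ⊔ ℓ) where
        field
          p∉⟨B⟩           : ¬ p ∈⟨ B ⟩
          B-independent   : Independent B
          pre⊆⟨B⟩         : ∀ j → pre j ∈⟨ B ⟩
          B⊆⟨pre++hb⟩     : ∀ j → B j ∈⟨ pre ++ hb ⟩
          pre-independent : Independent pre
      open Invariant

      Grows? : ∀ {d} (B : Fin d → Vec k) v → Dec (¬ v ∈⟨ p ∷ B ⟩)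
      Grows? B v = ¬? (v ∈⟨ p ∷ B ⟩?)

      Stays? : ∀ {i d} (pre : Fin i → Vec k) (B : Fin d → Vec k) v → Dec (v ∈⟨ B ⟩ × ¬ v ∈⟨ pre ⟩)
      Stays? pre B v = v ∈⟨ B ⟩? ×-dec ¬? (v ∈⟨ pre ⟩?)

      extensionSum≤disjointFrameBound : ∀ r {i d} (pre : Fin i → Vec k) (B : Fin d → Vec k) → Invariant pre B →
        extensionSum (indicator ∘ avoiding?) pre r ≤ disjointFrameBound q k i d r

      extend-bound : ∀ r {i d} (pre : Fin i → Vec k) (B : Fin d → Vec k) → Invariant pre B → ∀ v →
        extensionSum (indicator ∘ avoiding?) (v ∷ pre) r
          ≤ indicator (Grows? B v) * disjointFrameBound q k (suc i) (suc d) r + indicator (Stays? pre B v) * disjointFrameBound q k (suc i) d r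

      extensionSum≤disjointFrameBound zero    pre B inv = indicator≤1 (avoiding? pre)
      extensionSum≤disjointFrameBound (suc r) {i} {d} pre B inv = begin
        sumOver (λ v → extensionSum (indicator ∘ avoiding?) (v ∷ pre) r) (vectors k)
          ≤⟨ sumOver-mono-≤ (vectors k) (extend-bound r pre B inv) ⟩
        sumOver (λ v → indicator (Grows? B v) * Ta + indicator (Stays? pre B v) * Tb) (vectors k)
          ≡⟨ trans (sumOver-+ _ _ (vectors k)) (cong₂ _+_ (sumOver-*ʳ _ Ta (vectors k)) (sumOver-*ʳ _ Tb (vectors k))) ⟩
        size (Grows? B) * Ta + size (Stays? pre B) * Tb
          ≤⟨ +-mono-≤ (*-monoˡ-≤ Ta grows≤) (*-monoˡ-≤ Tb stays≤) ⟩
        (q ^ k ∸ q ^ suc d) * Ta + (q ^ d ∸ q ^ i) * Tb ∎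
        where
          open ≤-Reasoning
          Ta = disjointFrameBound q k (suc i) (suc d) r
          Tb = disjointFrameBound q k (suc i) d r
          grows≤ : size (Grows? B) ≤ q ^ k ∸ q ^ suc d
          grows≤ = begin
            size (Grows? B)
              ≡⟨ m≡n+o⇒m∸n≡o (sym (trans (count+count¬≡length (_∈⟨ p ∷ B ⟩?) (vectors k)) (vectors-length k))) ⟨
            q ^ k ∸ size (_∈⟨ p ∷ B ⟩?)            ≤⟨ ∸-monoʳ-≤ (q ^ k) (size-⟨⟩≥ {b = p ∷ B} (p∉⟨B⟩ inv , B-independent inv)) ⟩
            q ^ k ∸ q ^ suc d                      ∎
          stays≤ : size (Stays? pre B) ≤ q ^ d ∸ q ^ i
          stays≤ = subst (_≤ q ^ d ∸ q ^ i) (sym (count-∖ (_∈⟨ B ⟩?) (_∈⟨ pre ⟩?) (λ _ → ⟨⟩-mono (pre⊆⟨B⟩ inv)) (vectors k)))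
                     (∸-mono (size-⟨⟩≤ B) (size-⟨⟩≥ (pre-independent inv)))

      extend-bound r {i} {d} pre B inv v = classify (v ∈⟨ pre ⟩?) (v ∈⟨ B ⟩?) (v ∈⟨ p ∷ B ⟩?)
        where
          open ≤-Reasoning
          Ta = disjointFrameBound q k (suc i) (suc d) r
          Tb = disjointFrameBound q k (suc i) d r
          E  = extensionSum (indicator ∘ avoiding?) (v ∷ pre) r

          classify : Dec (v ∈⟨ pre ⟩) → Dec (v ∈⟨ B ⟩) → Dec (v ∈⟨ p ∷ B ⟩) →
                     E ≤ indicator (Grows? B v) * Ta + indicator (Stays? pre B v) * Tb
          classify (yes v∈⟨pre⟩) _ _ =
            ≤-trans (≤-reflexive (hopeless⇒extensionSum≡0 r (inj₁ (λ (v∉⟨pre⟩ , _) → v∉⟨pre⟩ v∈⟨pre⟩)))) z≤n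
          classify (no v∉⟨pre⟩) (yes v∈⟨B⟩) _ = begin
            E                                                 ≤⟨ extensionSum≤disjointFrameBound r (v ∷ pre) B stays ⟩
            Tb                                                ≡⟨ +-identityʳ Tb ⟨
            1 * Tb                                            ≡⟨ cong (_* Tb) (indicator-yes (Stays? pre B v) (v∈⟨B⟩ , v∉⟨pre⟩)) ⟨
            indicator (Stays? pre B v) * Tb                   ≤⟨ m≤n+m _ _ ⟩
            indicator (Grows? B v) * Ta + indicator (Stays? pre B v) * Tb ∎
            where
              stays : Invariant (v ∷ pre) B
              stays = record
                { p∉⟨B⟩ = p∉⟨B⟩ inv ; B-independent = B-independent inv
                ; pre⊆⟨B⟩ = λ { zero → v∈⟨B⟩ ; (suc j) → pre⊆⟨B⟩ inv j }
                ; B⊆⟨pre++hb⟩ = λ j → ∈⟨⟩-∷-++ v pre (B⊆⟨pre++hb⟩ inv j)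
                ; pre-independent = v∉⟨pre⟩ , pre-independent inv }
          classify (no _) (no v∉⟨B⟩) (yes v∈⟨p∷B⟩) =
            ≤-trans (≤-reflexive (hopeless⇒extensionSum≡0 r (inj₂ p∈))) z≤n
            where
              generators : ∀ j → (v ∷ B) j ∈⟨ (v ∷ pre) ++ hb ⟩
              generators zero    = generator-∈⟨⟩ ((v ∷ pre) ++ hb) zero
              generators (suc j) = ∈⟨⟩-∷-++ v pre (B⊆⟨pre++hb⟩ inv j)
              p∈ : p ∈⟨ (v ∷ pre) ++ hb ⟩
              p∈ = ⟨⟩-mono {b′ = (v ∷ pre) ++ hb} generators (exchange v∈⟨p∷B⟩ v∉⟨B⟩)
          classify (no v∉⟨pre⟩) (no v∉⟨B⟩) (no v∉⟨p∷B⟩) = begin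
            E                                                 ≤⟨ extensionSum≤disjointFrameBound r (v ∷ pre) (v ∷ B) grows ⟩
            Ta                                                ≡⟨ +-identityʳ Ta ⟨
            1 * Ta                                            ≡⟨ cong (_* Ta) (indicator-yes (Grows? B v) v∉⟨p∷B⟩) ⟨
            indicator (Grows? B v) * Ta                       ≤⟨ m≤m+n _ _ ⟩
            indicator (Grows? B v) * Ta + indicator (Stays? pre B v) * Tb ∎
            where
              grows : Invariant (v ∷ pre) (v ∷ B)
              grows = record
                { p∉⟨B⟩ = λ p∈⟨v∷B⟩ → v∉⟨p∷B⟩ (exchange p∈⟨v∷B⟩ (p∉⟨B⟩ inv))
                ; B-independent = v∉⟨B⟩ , B-independent inv
                ; pre⊆⟨B⟩ = λ { zero → generator-∈⟨⟩ (v ∷ B) zero ; (suc j) → ∈⟨tail⟩⇒∈⟨⟩ {b = v ∷ B} (pre⊆⟨B⟩ inv j) }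
                ; B⊆⟨pre++hb⟩ = λ { zero → generator-∈⟨⟩ ((v ∷ pre) ++ hb) zero ; (suc j) → ∈⟨⟩-∷-++ v pre (B⊆⟨pre++hb⟩ inv j) }
                ; pre-independent = v∉⟨pre⟩ , pre-independent inv }

  frames-bound : ∀ {k s} (H : AffineSubspace k) → AffineHasDim H (k ∸ s) → AvoidsOrigin H → ∀ n → IsCount s H n →
    n * frameCount q s 0 s ≤ disjointFrameBound q k 0 (k ∸ s) s
  frames-bound {k} {s} H (hb , hb⊆dir , hb-independent , _) avoids-origin n (W , counted , W-injective , _) = begin
    n * frameCount q s 0 s                                         ≤⟨ n*m≤sum n _ (λ j → Inside.frameCount≤extensionSum j s [] (lift tt , λ ())) ⟩
    sum (λ j → extensionSum (indicator ∘ Inside.inside? j) [] s)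
      ≤⟨ sum-extensionSum≤ n (λ j → indicator ∘ Inside.inside? j) (indicator ∘ avoiding?) s leaf-bound s [] refl ⟩
    extensionSum (indicator ∘ avoiding?) [] s                      ≤⟨ extensionSum≤disjointFrameBound s [] hb initial ⟩
    disjointFrameBound q k 0 (k ∸ s) s                             ∎
    where
      open ≤-Reasoning
      dir = AffineSubspace.direction H
      basis : ∀ j → Fin s → Vec k
      basis j = proj₁ (proj₁ (counted j))
      basis⊆W : ∀ j m → (W j ∈S) (basis j m)
      basis⊆W j = proj₁ (proj₂ (proj₁ (counted j)))
      W⊆⟨basis⟩ : ∀ j {x} → (W j ∈S) x → x ∈⟨ basis j ⟩
      W⊆⟨basis⟩ j {x} = proj₂ (proj₂ (proj₂ (proj₁ (counted j)))) x
      module Inside (j : Fin n) = InsideSpan (basis j) (LinearlyIndependent⇒Independent (proj₁ (proj₂ (proj₂ (proj₁ (counted j))))))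
      open AvoidingPoint hb (AffineSubspace.point H)

      initial : Invariant [] hb
      initial = record
        { p∉⟨B⟩ = λ p∈⟨hb⟩ → avoids-origin (point∈direction⇒0∈A H (⟨⟩-least dir hb⊆dir p∈⟨hb⟩))
        ; B-independent = LinearlyIndependent⇒Independent hb-independent
        ; pre⊆⟨B⟩ = λ ()
        ; B⊆⟨pre++hb⟩ = λ j → ∈⟨⟩-++ʳ [] (generator-∈⟨⟩ hb j)
        ; pre-independent = lift tt }

      inside⇒avoiding : ∀ (t : Fin s → Vec k) j → Inside.Inside j t → Avoiding t
      inside⇒avoiding t j (t-independent , t⊆⟨basis⟩) = t-independent ,
        Disjoint⇒point∉⟨⟩ H (W j) (proj₂ (counted j)) (λ m → ⟨⟩-least (W j) (basis⊆W j) (t⊆⟨basis⟩ m)) hb⊆dir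

      inside-unique : ∀ (t : Fin s → Vec k) j j′ → Inside.Inside j t → Inside.Inside j′ t → j ≡ j′
      inside-unique t j j′ (t-independent , t⊆j) (_ , t⊆j′) = W-injective j j′ λ x →
        mk⇔ (⊆-by-common-frame (W j) (W j′) (W⊆⟨basis⟩ j) (basis⊆W j′) t-independent t⊆j t⊆j′)
            (⊆-by-common-frame (W j′) (W j) (W⊆⟨basis⟩ j′) (basis⊆W j) t-independent t⊆j′ t⊆j)

      leaf-bound : ∀ (t : Fin s → Vec k) → sum (λ j → indicator (Inside.inside? j t)) ≤ indicator (avoiding? t)
      leaf-bound t = sum-indicator≤indicator n (λ j → Inside.inside? j t) (avoiding? t) (inside⇒avoiding t) (inside-unique t)

open import Data.Nat using (ℕ; zero; suc; _+_; _*_; _∸_; _^_; _≤_)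
open import Data.Product using (_,_)

lemma3p1 : ∀ {c ℓ} (q : ℕ) (𝔽 : FiniteField c ℓ q) (k s : ℕ) → 2 ≤ s → s ≤ k →
    (H : Geometry.AffineSubspace 𝔽 k) → Geometry.AffineHasDim 𝔽 H (k ∸ s) → Geometry.AvoidsOrigin 𝔽 H →
    (n : ℕ) → Geometry.IsCount 𝔽 s H n →
    n * q ^ 4 * gaussDen q s ≤ (q ^ 3 ∸ q + 1) * gaussNum q k s
lemma3p1 zero    𝔽 _ _ _ _ _ _ _ _ _ with FiniteField.enum-surj 𝔽 (FiniteField.0# 𝔽)
... | () , _
lemma3p1 (suc m) 𝔽 k s 2≤s s≤k H dimH avoids-origin n count =
  FrameArithmetic.Bounds.gaussian-bound m {n} s 2≤s s≤k (FrameCounting.frames-bound 𝔽 H dimH avoids-origin n count)
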